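{- Let $k\ge1$ be an integer, let $\mathcal C$ be a finite set of colors with $|\mathcal C|\ge 3k-1$, let $G$ be a $\mathcal C$-inextensible graph, let $\chi:=\chi(G)$, let $S_1\cup\cdots\cup S_\chi$ be a partition of $V(G)$ into $\chi$ stable sets, and let $T=(S,c,F)$ be a good $\mathcal C$-template on $G$. For $i\in[\chi]$ let $P_i:=S_i\setminus S$ and $p_i:=\lfloor w(P_i)/k\rfloor$, where $w(P):=\sum_{v\in P}|F(v)|$ for $P\subset V(G)\setminus S$. Then there exist integers $q_1,\dots,q_\chi$ with $0\le q_i\le p_i$ for all $i$, and subsets $P_1'\subset P_1,\dots,P_\chi'\subset P_\chi$, such that: (i) for every $i\in[\chi]$, $w(P_i')\ge q_ik$, and, setting $t_i:=p_i-q_i$, there is a partition $P_i\setminus P_i'=\bigcup_{j\in[t_i+1]}P_{ij}$ into $t_i+1$ sets with $w(P_{ij})<k$ for all $j\in[t_i+1]$; and (ii) for $P^1:=\bigcup_{i\in[\chi]}P_i'$, there is a proper $\mathcal C$-coloring $c_1$ of $G[S\cup P^1]$ with $c_1|_S=c$ and $c_1(v)\notin F(v)$ for all $v\in P^1$, such that $|c_1(P_i')|\le q_i$ for all $i\in[\chi]$.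
   Context: All graphs are finite and simple; $\chi(G)$ is the chromatic number; $[n]=\{1,\dots,n\}$ ($[0]=\emptyset$); for a map $f$ and set $A$, $f(A)=\{f(a):a\in A\}$. For a finite set $\mathcal C$ of colors, a proper $\mathcal C$-coloring of $G$ is a map $f:V(G)\to\mathcal C$ with $f(u)\ne f(v)$ for adjacent $u,v$. A $\mathcal C$-template on $G$ is a triple $T=(S,c,F)$ where $S\subset V(G)$, $c:S\to\mathcal C$ is a proper $\mathcal C$-coloring of $G[S]$, and $F$ assigns to each $v\in V(G)\setminus S$ a subset $F(v)\subset\mathcal C$. For the fixed $k$, $\mathrm{cost}(T)=k|S|+\sum_{v\in V(G)\setminus S}|F(v)|$. A proper $\mathcal C$-coloring $f$ of $G$ respects $T$ if $f|_S=c$ and $f(v)\notin F(v)$ for all $v\in V(G)\setminus S$. $T$ witnesses the $\mathcal C$-inextensibility of $G$ if $\mathrm{cost}(T)<2k^2$, $|F(v)|\le k$ for all $v\in V(G)\setminus S$, and no proper $\mathcal C$-coloring of $G$ respects $T$; $G$ is $\mathcal C$-inextensible if such $T$ exists. A template $T=(S,c,F)$ is good if it witnesses the $\mathcal C$-inextensibility of $G$ and $|F(v)|\le k-1$ for all $v\in V(G)\setminus S$. -}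

module Defs where

open import Data.Nat using (ℕ; zero; suc; _+_; _*_; _∸_; _≤_; _<_; NonZero)
open import Data.Nat.DivMod using (_/_)
open import Data.Bool using (Bool; true; false; _∧_; _∨_; not; if_then_else_)
open import Data.Fin using (Fin; _≟_)
open import Data.Fin.Subset using (Subset; _∈_; _∉_; _⊆_; ∣_∣)
open import Data.Vec using (Vec; lookup; tabulate; foldr)
open import Data.Product using (Σ; ∃; ∃-syntax; _×_; _,_)
open import Data.Sum using (_⊎_)
open import Relation.Nullary using (¬_; ⌊_⌋)
open import Relation.Binary.PropositionalEquality using (_≡_; _≢_)

record Graph (n : ℕ) : Set where
  field
    adj   : Fin n → Fin n → Bool
    sym   : ∀ u v → adj u v ≡ adj v u
    irrefl : ∀ v → adj v v ≡ false

open Graph public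

Adj : ∀ {n} → Graph n → Fin n → Fin n → Set
Adj G u v = adj G u v ≡ true

IsProperColoring : ∀ {n r} → Graph n → (Fin n → Fin r) → Set
IsProperColoring G f = ∀ u v → Adj G u v → f u ≢ f v

IsChromaticNumber : ∀ {n} → Graph n → ℕ → Set
IsChromaticNumber {n} G χ =
  (∃[ f ] IsProperColoring {n} {χ} G f)
  × (∀ r (f : Fin n → Fin r) → IsProperColoring G f → χ ≤ r)

ΣFin : ∀ n → (Fin n → ℕ) → ℕ
ΣFin n f = foldr (λ _ → ℕ) _+_ 0 (tabulate f)

anyFin : ∀ n → (Fin n → Bool) → Bool
anyFin n p = foldr (λ _ → Bool) _∨_ false (tabulate p)

-- C-template (S, c, F) on G with color set C = Fin m.
-- c is given on all vertices but only its values on S matter;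
-- F is given on all vertices but only its values off S matter.
record Template (n m : ℕ) : Set where
  field
    S : Subset n
    c : Fin n → Fin m
    F : Fin n → Subset m

open Template public

module _ {n m : ℕ} (k : ℕ) (G : Graph n) (T : Template n m) where

  TemplateProper : Set
  TemplateProper = ∀ u v → u ∈ S T → v ∈ S T → Adj G u v → c T u ≢ c T v

  cost : ℕ
  cost = k * ∣ S T ∣ + ΣFin n (λ v → if lookup (S T) v then 0 else ∣ F T v ∣)

  Respects : (Fin n → Fin m) → Set
  Respects f = IsProperColoring G f
             × (∀ v → v ∈ S T → f v ≡ c T v)
             × (∀ v → v ∉ S T → f v ∉ F T v)

  Witnesses : Set
  Witnesses = TemplateProper
            × cost < 2 * k * k
            × (∀ v → v ∉ S T → ∣ F T v ∣ ≤ k)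
            × (¬ (∃[ f ] Respects f))

  Good : Set
  Good = Witnesses × (∀ v → v ∉ S T → ∣ F T v ∣ ≤ k ∸ 1)

  w : Subset n → ℕ
  w P = ΣFin n (λ v → if lookup P v then ∣ F T v ∣ else 0)

Inextensible : ∀ {n} (k m : ℕ) → Graph n → Set
Inextensible {n} k m G = ∃[ T ] Witnesses {n} {m} k G T

Pclass : ∀ {n m χ} → Template n m → (Fin n → Fin χ) → Fin χ → Subset n
Pclass T s i = tabulate (λ v → ⌊ s v ≟ i ⌋ ∧ not (lookup (S T) v))

pval : ∀ {n m χ} (k : ℕ) .{{_ : NonZero k}} (G : Graph n) → Template n m
     → (Fin n → Fin χ) → Fin χ → ℕ
pval k G T s i = w k G T (Pclass T s i) / k

cell : ∀ {n t} → Subset n → Subset n → (Fin n → Fin t) → Fin t → Subset n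
cell A B part j = tabulate (λ v → lookup A v ∧ not (lookup B v) ∧ ⌊ part v ≟ j ⌋)

image : ∀ {n m} → (Fin n → Fin m) → Subset n → Subset m
image {n} f P = tabulate (λ col → anyFin n (λ v → lookup P v ∧ ⌊ f v ≟ col ⌋))

{-# OPTIONS --safe #-}
module Submission where

-- Treat the classes P_i one after another, each with a palette of colours unused
-- by c(S) and by the palettes of the earlier classes.  Inside a class L with w(L) < (r+1)k and
-- at least k + r - 1 colours available, some available colour δ is forbidden only on a set of
-- weight < rk: otherwise, since |F(v)| < k, each of at least k available colours would be
-- forbidden by r + 1 vertices of L, and counting the pairs (δ, v) with δ ∈ F(v) would give
-- w(L) ≥ (r+1)k.  The vertices of L admitting δ either weigh at least k, and then all get
-- colour δ (q grows by one), or weigh less than k, and then they form one part of the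
-- partition; either way we recurse on the vertices forbidding δ with budget r - 1.  The
-- palettes never run out: k|S| + k Σ p_i ≤ cost(T) < 2k² gives |S| + Σ p_i ≤ 2k - 1.

open import Defs hiding (sym)
open import Data.Nat using (ℕ; zero; suc; _+_; _*_; _∸_; _≤_; _<_; z≤n; s≤s; _≤?_; _<?_; NonZero)
open import Data.Nat.Properties
  using ( ≤-trans; ≤-reflexive; ≤-<-trans; <-≤-trans; ≤-pred; n≤1+n; n<1+n; m≤n⇒m≤1+n; m≤m+n
        ; m+n≤o⇒m≤o; m+n≤o⇒m≤o∸n; m+n∸m≡n; <⇒≱; ≰⇒>
        ; +-assoc; +-comm; +-suc; +-identityʳ; +-mono-≤; +-monoʳ-≤; +-monoˡ-<; +-cancelʳ-≤
        ; *-comm; *-zeroʳ; *-distribˡ-+; *-monoˡ-≤; *-monoʳ-<; *-cancelˡ-<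
        ; +-*-semiring; +-commutativeSemigroup; module ≤-Reasoning )
open import Data.Nat.DivMod using (_/_; _%_; m≡m%n+[m/n]*n; m%n<n; m/n*n≤m)
open import Data.Nat.Tactic.RingSolver using (solve-∀)
open import Algebra.Properties.CommutativeSemigroup +-commutativeSemigroup
  using (interchange; x∙yz≈y∙xz)
open import Algebra.Properties.Semiring.Sum +-*-semiring
  using (sum; sum-cong-≗; ∑-comm; *-distribʳ-sum)
open import Data.Bool using (Bool; true; false; _∧_; not; if_then_else_)
open import Data.Fin using (Fin; zero; suc; _≟_)
open import Data.Fin.Properties using (any?; suc-injective)
open import Data.Fin.Subset
  using (Subset; _∈_; _∉_; _⊆_; ∣_∣; _∪_; _∩_; _─_; _-_; ∁; ⁅_⁆; inside; outside)
  renaming (⊥ to ∅)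
open import Data.Fin.Subset.Properties
  using ( _∈?_; drop-∷-⊆; ⊥⊆; ∉⊥; ∣⊥∣≡0; x∈⁅x⁆; x∈⁅y⁆⇒x≡y; ∣⁅x⁆∣≡1; ∣p∣≤∣x∷p∣; p⊆q⇒∣p∣≤∣q∣
        ; x∈∁p⇒x∉p; x∉p⇒x∈∁p; ∣∁p∣≡n∸∣p∣; p⊆q⇒∁p⊇∁q; x∈p∩q⁺; x∈p∩q⁻; p∩q⊆p
        ; p⊆p∪q; q⊆p∪q; x∈p∪q⁺; x∈p∪q⁻; x∈p∧x∉q⇒x∈p─q; p─q⊆p; x∈p∧x≢y⇒x∈p-y )
open import Data.Vec using ([]; _∷_; here; there; lookup; tabulate)
open import Data.Vec.Properties using (lookup∘tabulate; []=⇒lookup; lookup⇒[]=)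
open import Data.Product using (Σ; ∃-syntax; _×_; _,_; proj₁; proj₂)
open import Data.Sum using (_⊎_; inj₁; inj₂; [_,_]′)
open import Function using (_∘_; id; flip)
open import Relation.Nullary using (⌊_⌋; yes; no; contradiction; _×-dec_)
open import Relation.Binary.PropositionalEquality
  using (_≡_; _≢_; refl; sym; trans; cong; subst; module ≡-Reasoning)

ΣFin≡sum : ∀ {n} (f : Fin n → ℕ) → ΣFin n f ≡ sum f
ΣFin≡sum {zero}  f = refl
ΣFin≡sum {suc n} f = cong (f zero +_) (ΣFin≡sum (f ∘ suc))

ΣFin-cong : ∀ {n} {f g : Fin n → ℕ} → (∀ i → f i ≡ g i) → ΣFin n f ≡ ΣFin n g
ΣFin-cong {f = f} {g} f≗g = trans (ΣFin≡sum f) (trans (sum-cong-≗ f≗g) (sym (ΣFin≡sum g)))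

ΣFin-mono : ∀ {n} {f g : Fin n → ℕ} → (∀ i → f i ≤ g i) → ΣFin n f ≤ ΣFin n g
ΣFin-mono {zero}  f≤g = z≤n
ΣFin-mono {suc n} f≤g = +-mono-≤ (f≤g zero) (ΣFin-mono (f≤g ∘ suc))

ΣFin-comm : ∀ {a c} (f : Fin a → Fin c → ℕ) →
            ΣFin a (λ i → ΣFin c (f i)) ≡ ΣFin c (λ j → ΣFin a (λ i → f i j))
ΣFin-comm {a} {c} f = begin
  ΣFin a (λ i → ΣFin c (f i))      ≡⟨ ΣFin≡sum (λ i → ΣFin c (f i)) ⟩
  sum (λ i → ΣFin c (f i))         ≡⟨ sum-cong-≗ (λ i → ΣFin≡sum (f i)) ⟩
  sum (λ i → sum (f i))            ≡⟨ ∑-comm f ⟩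
  sum (λ j → sum (λ i → f i j))    ≡⟨ sum-cong-≗ (λ j → sym (ΣFin≡sum (λ i → f i j))) ⟩
  sum (λ j → ΣFin a (λ i → f i j)) ≡⟨ sym (ΣFin≡sum (λ j → ΣFin a (λ i → f i j))) ⟩
  ΣFin c (λ j → ΣFin a (λ i → f i j)) ∎
  where open ≡-Reasoning

ΣFin-*ʳ : ∀ {n} (f : Fin n → ℕ) x → ΣFin n f * x ≡ ΣFin n (λ i → f i * x)
ΣFin-*ʳ f x = begin
  ΣFin _ f * x            ≡⟨ cong (_* x) (ΣFin≡sum f) ⟩
  sum f * x               ≡⟨ *-distribʳ-sum x f ⟩
  sum (λ i → f i * x)     ≡⟨ sym (ΣFin≡sum (λ i → f i * x)) ⟩
  ΣFin _ (λ i → f i * x)  ∎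
  where open ≡-Reasoning

ΣFin-zero : ∀ n → ΣFin n (λ _ → 0) ≡ 0
ΣFin-zero zero    = refl
ΣFin-zero (suc n) = ΣFin-zero n

ΣFin-one-hot : ∀ {c} (x : Fin c) b y →
               ΣFin c (λ i → if ⌊ x ≟ i ⌋ ∧ b then y else 0) ≡ (if b then y else 0)
ΣFin-one-hot {suc c} zero    b y =
  trans (cong ((if b then y else 0) +_) (ΣFin-zero c)) (+-identityʳ _)
ΣFin-one-hot {suc c} (suc x) b y =
  trans (ΣFin-cong (λ i → cong (λ e → if e ∧ b then y else 0) (⌊suc≟suc⌋ x i))) (ΣFin-one-hot x b y)
  where
  -- ⌊_⌋ inspects the Dec constructor, so it does not compute through the suc case of _≟_.
  ⌊suc≟suc⌋ : ∀ (x i : Fin c) → ⌊ suc x ≟ suc i ⌋ ≡ ⌊ x ≟ i ⌋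
  ⌊suc≟suc⌋ x i with x ≟ i
  ... | yes _ = refl
  ... | no  _ = refl

∈-tabulate⁻ : ∀ {n} {g : Fin n → Bool} {v} → v ∈ tabulate g → g v ≡ true
∈-tabulate⁻ {g = g} {v} v∈ = trans (sym (lookup∘tabulate g v)) ([]=⇒lookup v∈)

∈-tabulate⁺ : ∀ {n} {g : Fin n → Bool} {v} → g v ≡ true → v ∈ tabulate g
∈-tabulate⁺ {g = g} {v} gv = lookup⇒[]= v _ (trans (lookup∘tabulate g v) gv)

∉⇒lookup≡false : ∀ {n} {p : Subset n} {v} → v ∉ p → lookup p v ≡ false
∉⇒lookup≡false {p = p} {v} v∉p with lookup p v in eq
... | true  = contradiction (lookup⇒[]= v p eq) v∉p
... | false = refl

lookup≡false⇒∉ : ∀ {n} {p : Subset n} {v} → lookup p v ≡ false → v ∉ p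
lookup≡false⇒∉ eq v∈p with () ← trans (sym ([]=⇒lookup v∈p)) eq

∈-cell⁻ : ∀ {n t} (A B : Subset n) (part : Fin n → Fin t) j {v} →
          v ∈ cell A B part j → v ∈ A × v ∉ B × part v ≡ j
∈-cell⁻ A B part j {v} v∈cell
  with lookup A v in v∈A | lookup B v in v∈B | part v ≟ j | ∈-tabulate⁻ v∈cell
... | true  | false | yes eq | _ = lookup⇒[]= v A v∈A , lookup≡false⇒∉ v∈B , eq
... | true  | true  | _      | ()
... | true  | false | no _   | ()
... | false | _     | _      | ()

∈-cell⁺ : ∀ {n t} (A B : Subset n) (part : Fin n → Fin t) j {v} →
          v ∈ A → v ∉ B → part v ≡ j → v ∈ cell A B part j
∈-cell⁺ A B part j {v} v∈A v∉B part≡j = ∈-tabulate⁺ bits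
  where
  bits : (lookup A v ∧ not (lookup B v) ∧ ⌊ part v ≟ j ⌋) ≡ true
  bits rewrite []=⇒lookup v∈A | ∉⇒lookup≡false v∉B | part≡j with j ≟ j
  ... | yes _  = refl
  ... | no j≢j = contradiction refl j≢j

∈-Pclass⁻ : ∀ {n m χ} {T : Template n m} {s : Fin n → Fin χ} {i v} →
            v ∈ Pclass T s i → s v ≡ i × v ∉ S T
∈-Pclass⁻ {T = T} {s} {i} {v} v∈P with s v ≟ i | lookup (S T) v in v∈S | ∈-tabulate⁻ v∈P
... | yes eq | false | _ = eq , lookup≡false⇒∉ v∈S
... | yes _  | true  | ()
... | no _   | _     | ()

anyFin⁻ : ∀ n (g : Fin n → Bool) → anyFin n g ≡ true → ∃[ v ] g v ≡ true
anyFin⁻ (suc n) g any with g zero in g0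
... | true  = zero , g0
... | false = let v , gv = anyFin⁻ n (g ∘ suc) any in suc v , gv

anyFin⁺ : ∀ n (g : Fin n → Bool) v → g v ≡ true → anyFin n g ≡ true
anyFin⁺ (suc n) g zero    gv rewrite gv = refl
anyFin⁺ (suc n) g (suc v) gv with g zero
... | true  = refl
... | false = anyFin⁺ n (g ∘ suc) v gv

∈-image⁻ : ∀ {n m} {f : Fin n → Fin m} {P : Subset n} {γ} →
           γ ∈ image f P → ∃[ v ] v ∈ P × f v ≡ γ
∈-image⁻ {n} {f = f} {P} {γ} γ∈ with anyFin⁻ n _ (∈-tabulate⁻ γ∈)
... | v , hit with lookup P v in v∈P | f v ≟ γ | hit
...   | true | yes eq | _ = v , lookup⇒[]= v P v∈P , eq
...   | true | no _   | ()
...   | false | _     | ()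

∈-image⁺ : ∀ {n m} {f : Fin n → Fin m} {P : Subset n} {v} → v ∈ P → f v ∈ image f P
∈-image⁺ {n} {f = f} {P} {v} v∈P = ∈-tabulate⁺ (anyFin⁺ n _ v hit)
  where
  hit : (lookup P v ∧ ⌊ f v ≟ f v ⌋) ≡ true
  hit rewrite []=⇒lookup v∈P with f v ≟ f v
  ... | yes _  = refl
  ... | no neq = contradiction refl neq

∪-⊆ : ∀ {n} {p q r : Subset n} → p ⊆ r → q ⊆ r → p ∪ q ⊆ r
∪-⊆ {p = p} {q} p⊆r q⊆r x∈ = [ p⊆r , q⊆r ]′ (x∈p∪q⁻ p q x∈)

∣p∪q∣≤∣p∣+∣q∣ : ∀ {n} (p q : Subset n) → ∣ p ∪ q ∣ ≤ ∣ p ∣ + ∣ q ∣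
∣p∪q∣≤∣p∣+∣q∣ []            []            = z≤n
∣p∪q∣≤∣p∣+∣q∣ (inside  ∷ p) (inside  ∷ q) =
  s≤s (≤-trans (∣p∪q∣≤∣p∣+∣q∣ p q) (+-monoʳ-≤ ∣ p ∣ (n≤1+n ∣ q ∣)))
∣p∪q∣≤∣p∣+∣q∣ (inside  ∷ p) (outside ∷ q) = s≤s (∣p∪q∣≤∣p∣+∣q∣ p q)
∣p∪q∣≤∣p∣+∣q∣ (outside ∷ p) (inside  ∷ q) =
  ≤-trans (s≤s (∣p∪q∣≤∣p∣+∣q∣ p q)) (≤-reflexive (sym (+-suc ∣ p ∣ ∣ q ∣)))
∣p∪q∣≤∣p∣+∣q∣ (outside ∷ p) (outside ∷ q) = ∣p∪q∣≤∣p∣+∣q∣ p q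

∣p∣≤1+∣p-x∣ : ∀ {n} (p : Subset n) x → ∣ p ∣ ≤ suc ∣ p - x ∣
∣p∣≤1+∣p-x∣ p x = ≤-trans (p⊆q⇒∣p∣≤∣q∣ p⊆⁅x⁆∪[p-x]) (≤-trans (∣p∪q∣≤∣p∣+∣q∣ ⁅ x ⁆ (p - x))
                    (≤-reflexive (cong (_+ ∣ p - x ∣) (∣⁅x⁆∣≡1 x))))
  where
  p⊆⁅x⁆∪[p-x] : p ⊆ ⁅ x ⁆ ∪ (p - x)
  p⊆⁅x⁆∪[p-x] {y} y∈p with y ≟ x
  ... | yes refl = x∈p∪q⁺ (inj₁ (x∈⁅x⁆ x))
  ... | no  y≢x  = x∈p∪q⁺ (inj₂ (x∈p∧x≢y⇒x∈p-y y∈p y≢x))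

∣∁p∣≤∣∁[p∪q]∣+∣q∣ : ∀ {n} (p q : Subset n) → ∣ ∁ p ∣ ≤ ∣ ∁ (p ∪ q) ∣ + ∣ q ∣
∣∁p∣≤∣∁[p∪q]∣+∣q∣ p q = ≤-trans (p⊆q⇒∣p∣≤∣q∣ ∁p⊆∁[p∪q]∪q) (∣p∪q∣≤∣p∣+∣q∣ (∁ (p ∪ q)) q)
  where
  ∁p⊆∁[p∪q]∪q : ∁ p ⊆ ∁ (p ∪ q) ∪ q
  ∁p⊆∁[p∪q]∪q {y} y∈∁p with y ∈? q
  ... | yes y∈q = x∈p∪q⁺ (inj₂ y∈q)
  ... | no  y∉q = x∈p∪q⁺ (inj₁ (x∉p⇒x∈∁p ([ x∈∁p⇒x∉p y∈∁p , y∉q ]′ ∘ x∈p∪q⁻ p q)))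

∣image∣≤∣∣ : ∀ {n m} (f : Fin n → Fin m) (P : Subset n) → ∣ image f P ∣ ≤ ∣ P ∣
∣image∣≤∣∣ {m = m} f []            = ≤-trans (p⊆q⇒∣p∣≤∣q∣ image⊆∅) (≤-reflexive (∣⊥∣≡0 m))
  where
  image⊆∅ : image f [] ⊆ ∅
  image⊆∅ γ∈ with () ← proj₁ (∈-image⁻ {f = f} {P = []} γ∈)
∣image∣≤∣∣ f (outside ∷ P) = ≤-trans (p⊆q⇒∣p∣≤∣q∣ image⊆) (∣image∣≤∣∣ (f ∘ suc) P)
  where
  image⊆ : image f (outside ∷ P) ⊆ image (f ∘ suc) P
  image⊆ γ∈ with ∈-image⁻ {f = f} {P = outside ∷ P} γ∈
  ... | suc v , there v∈P , refl = ∈-image⁺ v∈P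
∣image∣≤∣∣ f (inside  ∷ P) =
  ≤-trans (p⊆q⇒∣p∣≤∣q∣ image⊆) (≤-trans (∣p∪q∣≤∣p∣+∣q∣ ⁅ f zero ⁆ (image (f ∘ suc) P))
    (+-mono-≤ (≤-reflexive (∣⁅x⁆∣≡1 (f zero))) (∣image∣≤∣∣ (f ∘ suc) P)))
  where
  image⊆ : image f (inside ∷ P) ⊆ ⁅ f zero ⁆ ∪ image (f ∘ suc) P
  image⊆ γ∈ with ∈-image⁻ {f = f} {P = inside ∷ P} γ∈
  ... | zero  , here       , refl = x∈p∪q⁺ (inj₁ (x∈⁅x⁆ (f zero)))
  ... | suc v , there v∈P , refl = x∈p∪q⁺ (inj₂ (∈-image⁺ v∈P))

x∈p─q⇒x∉q : ∀ {n} (p q : Subset n) {x} → x ∈ p ─ q → x ∉ q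
x∈p─q⇒x∉q (_ ∷ p) (_ ∷ q)       (there x∈) (there x∈q) = x∈p─q⇒x∉q p q x∈ x∈q

-- Weights of vertex sets

weight : ∀ {n} → (Fin n → ℕ) → Subset n → ℕ
weight f p = ΣFin _ (λ v → if lookup p v then f v else 0)

weight-cong : ∀ {n} {f g : Fin n → ℕ} (p : Subset n) → (∀ v → f v ≡ g v) →
              weight f p ≡ weight g p
weight-cong p f≗g = ΣFin-cong (λ v → cong (λ x → if lookup p v then x else 0) (f≗g v))

weight-⊆ : ∀ {n} (f : Fin n → ℕ) {p q : Subset n} → p ⊆ q → weight f p ≤ weight f q
weight-⊆ f {[]}          {[]}          _    = z≤n
weight-⊆ f {outside ∷ p} {_       ∷ q} p⊆q = +-mono-≤ z≤n (weight-⊆ (f ∘ suc) (drop-∷-⊆ p⊆q))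
weight-⊆ f {inside  ∷ p} {inside  ∷ q} p⊆q = +-monoʳ-≤ (f zero) (weight-⊆ (f ∘ suc) (drop-∷-⊆ p⊆q))
weight-⊆ f {inside  ∷ p} {outside ∷ q} p⊆q with () ← p⊆q here

weight-mono : ∀ {n} {f g : Fin n → ℕ} (p : Subset n) → (∀ {v} → v ∈ p → f v ≤ g v) →
              weight f p ≤ weight g p
weight-mono []            f≤g = z≤n
weight-mono (outside ∷ p) f≤g = weight-mono p (f≤g ∘ there)
weight-mono (inside  ∷ p) f≤g = +-mono-≤ (f≤g here) (weight-mono p (f≤g ∘ there))

weight-const : ∀ {n} (p : Subset n) c → weight (λ _ → c) p ≡ ∣ p ∣ * c
weight-const []            c = refl
weight-const (outside ∷ p) c = weight-const p c
weight-const (inside  ∷ p) c = cong (c +_) (weight-const p c)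

weight-+ : ∀ {n} (f g : Fin n → ℕ) (p : Subset n) →
           weight (λ v → f v + g v) p ≡ weight f p + weight g p
weight-+ f g []            = refl
weight-+ f g (outside ∷ p) = weight-+ (f ∘ suc) (g ∘ suc) p
weight-+ f g (inside  ∷ p) = trans (cong (f zero + g zero +_) (weight-+ (f ∘ suc) (g ∘ suc) p))
                                   (interchange (f zero) (g zero) _ _)

weight-∪ : ∀ {n} (f : Fin n → ℕ) {p q : Subset n} → (∀ {v} → v ∈ p → v ∉ q) →
           weight f (p ∪ q) ≡ weight f p + weight f q
weight-∪ f {[]}          {[]}          _ = refl
weight-∪ f {inside  ∷ p} {inside  ∷ q} disjoint = contradiction here (disjoint here)
weight-∪ f {inside  ∷ p} {outside ∷ q} disjoint =
  trans (cong (f zero +_) (weight-∪ (f ∘ suc) (λ v∈p → disjoint (there v∈p) ∘ there)))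
        (sym (+-assoc (f zero) _ _))
weight-∪ f {outside ∷ p} {y       ∷ q} disjoint =
  trans (cong (head +_) (weight-∪ (f ∘ suc) (λ v∈p → disjoint (there v∈p) ∘ there)))
        (x∙yz≈y∙xz head (weight (f ∘ suc) p) (weight (f ∘ suc) q))
  where head = if y then f zero else 0

weight-indicator≤∣∣ : ∀ {n} (p q : Subset n) →
                      weight (λ v → if lookup q v then 1 else 0) p ≤ ∣ q ∣
weight-indicator≤∣∣ []            []            = z≤n
weight-indicator≤∣∣ (outside ∷ p) (y       ∷ q) = ≤-trans (weight-indicator≤∣∣ p q) (∣p∣≤∣x∷p∣ y q)
weight-indicator≤∣∣ (inside  ∷ p) (outside ∷ q) = weight-indicator≤∣∣ p q
weight-indicator≤∣∣ (inside  ∷ p) (inside  ∷ q) = s≤s (weight-indicator≤∣∣ p q)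

forbidders : ∀ {n m} → (Fin n → Subset m) → Fin m → Subset n
forbidders F δ = tabulate (λ v → lookup (F v) δ)

∈-forbidders⁺ : ∀ {n m} {F : Fin n → Subset m} {δ v} → δ ∈ F v → v ∈ forbidders F δ
∈-forbidders⁺ δ∈Fv = ∈-tabulate⁺ ([]=⇒lookup δ∈Fv)

∣∷∣ : ∀ {n} x (p : Subset n) → ∣ x ∷ p ∣ ≡ (if x then 1 else 0) + ∣ p ∣
∣∷∣ inside  p = refl
∣∷∣ outside p = refl

weight-zero : ∀ {n} (p : Subset n) → weight (λ _ → 0) p ≡ 0
weight-zero p = trans (weight-const p 0) (*-zeroʳ ∣ p ∣)

-- Double counting the pairs (δ, v) with δ ∈ A ∩ F v and v ∈ L.
weight-∣∩forbidders∣≤weight : ∀ {n m} (F : Fin n → Subset m) (A : Subset m) (L : Subset n) →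
  weight (λ δ → ∣ L ∩ forbidders F δ ∣) A ≤ weight (λ v → ∣ F v ∣) L
weight-∣∩forbidders∣≤weight F A []      = ≤-reflexive (weight-zero A)
weight-∣∩forbidders∣≤weight F A (x ∷ L) = begin
  weight (λ δ → ∣ (x ∷ L) ∩ forbidders F δ ∣) A
    ≡⟨ weight-cong A (λ δ → ∣∷∣ (x ∧ lookup (F zero) δ) (L′ δ)) ⟩
  weight (λ δ → head x δ + ∣ L′ δ ∣) A
    ≡⟨ weight-+ (head x) (λ δ → ∣ L′ δ ∣) A ⟩
  weight (head x) A + weight (λ δ → ∣ L′ δ ∣) A
    ≤⟨ +-mono-≤ (weight-head x) (weight-∣∩forbidders∣≤weight (F ∘ suc) A L) ⟩
  (if x then ∣ F zero ∣ else 0) + weight (λ v → ∣ F (suc v) ∣) L ∎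
  where
  open ≤-Reasoning
  L′ : Fin _ → Subset _
  L′ δ = L ∩ forbidders (F ∘ suc) δ

  head : Bool → Fin _ → ℕ
  head x δ = if x ∧ lookup (F zero) δ then 1 else 0

  weight-head : ∀ x → weight (head x) A ≤ (if x then ∣ F zero ∣ else 0)
  weight-head true  = weight-indicator≤∣∣ A (F zero)
  weight-head false = ≤-reflexive (weight-zero A)

-- Colouring one class greedily

-- fallback only supplies the irrelevant colours of the vertices that are left uncoloured.
module Greedy {n m : ℕ} (b : ℕ) (F : Fin n → Subset m) (fallback : Fin n → Fin m) where

  k : ℕ
  k = suc b

  wF : Subset n → ℕ
  wF = weight (λ v → ∣ F v ∣)

  Bounded : Subset n → Set
  Bounded L = ∀ {v} → v ∈ L → ∣ F v ∣ ≤ b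

  wF-⊆ : ∀ {p q} → p ⊆ q → wF p ≤ wF q
  wF-⊆ = weight-⊆ _

  wF≤∣∣*b : ∀ {L} → Bounded L → wF L ≤ ∣ L ∣ * b
  wF≤∣∣*b {L} bounded = ≤-trans (weight-mono L bounded) (≤-reflexive (weight-const L b))

  admitting forbidding : Subset n → Fin m → Subset n
  admitting  L δ = L ─ forbidders F δ
  forbidding L δ = L ∩ forbidders F δ

  rarelyForbidden : ∀ {r L A} → Bounded L → wF L < suc (suc r) * k → k ≤ ∣ A ∣ →
                    ∃[ δ ] δ ∈ A × wF (forbidding L δ) < suc r * k
  rarelyForbidden {r} {L} {A} bounded light k≤∣A∣
    with any? (λ δ → δ ∈? A ×-dec wF (forbidding L δ) <? suc r * k)
  ... | yes found = found
  ... | no  none  = contradiction heavy (<⇒≱ light)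
    where
    crowded : ∀ {δ} → δ ∈ A → suc (suc r) ≤ ∣ forbidding L δ ∣
    crowded {δ} δ∈A = ≰⇒> λ few → none (δ , δ∈A , (begin-strict
      wF (forbidding L δ)         ≤⟨ wF≤∣∣*b (bounded ∘ proj₁ ∘ x∈p∩q⁻ L _) ⟩
      ∣ forbidding L δ ∣ * b      ≤⟨ *-monoˡ-≤ b few ⟩
      suc r * b                   <⟨ *-monoʳ-< (suc r) (n<1+n b) ⟩
      suc r * k                   ∎))
      where open ≤-Reasoning
    heavy : suc (suc r) * k ≤ wF L
    heavy = begin
      suc (suc r) * k                          ≡⟨ *-comm (suc (suc r)) k ⟩
      k * suc (suc r)                          ≤⟨ *-monoˡ-≤ (suc (suc r)) k≤∣A∣ ⟩
      ∣ A ∣ * suc (suc r)                      ≡⟨ sym (weight-const A (suc (suc r))) ⟩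
      weight (λ _ → suc (suc r)) A             ≤⟨ weight-mono A crowded ⟩
      weight (λ δ → ∣ forbidding L δ ∣) A      ≤⟨ weight-∣∩forbidders∣≤weight F A L ⟩
      wF L                                     ∎
      where open ≤-Reasoning

  -- X is the coloured part P′ of the class L, and part splits L ∖ X into t + 1 light cells.
  record ClassSplit (r : ℕ) (L : Subset n) (A : Subset m) : Set where
    field
      q t            : ℕ
      q+t≡r          : q + t ≡ r
      X              : Subset n
      X⊆L            : X ⊆ L
      palette        : Subset m
      palette⊆A      : palette ⊆ A
      ∣palette∣≤q    : ∣ palette ∣ ≤ q
      colour         : Fin n → Fin m
      colour∈palette : ∀ {v} → v ∈ X → colour v ∈ palette
      colour∉F       : ∀ {v} → v ∈ X → colour v ∉ F v
      q*k≤wX         : q * k ≤ wF X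
      part           : Fin n → Fin (suc t)
      cells-light    : ∀ j → wF (cell L X part j) < k

    q≤r : q ≤ r
    q≤r = ≤-trans (m≤m+n q t) (≤-reflexive q+t≡r)

    lightPartition : Σ (Fin n → Fin (suc (r ∸ q))) λ part → ∀ j → wF (cell L X part j) < k
    lightPartition = subst (λ t → Σ (Fin n → Fin (suc t)) λ part → ∀ j → wF (cell L X part j) < k)
                           (trans (sym (m+n∸m≡n q t)) (cong (_∸ q) q+t≡r)) (part , cells-light)

  noSplit : ∀ {L A} → wF L < k → ClassSplit 0 L A
  noSplit {L} light = record
    { q = 0 ; t = 0 ; q+t≡r = refl
    ; X = ∅ ; X⊆L = ⊥⊆ ; palette = ∅ ; palette⊆A = ⊥⊆ ; ∣palette∣≤q = ≤-reflexive (∣⊥∣≡0 m)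
    ; colour = fallback
    ; colour∈palette = λ v∈∅ → contradiction v∈∅ ∉⊥ ; colour∉F = λ v∈∅ → contradiction v∈∅ ∉⊥
    ; q*k≤wX = z≤n
    ; part = one-cell
    ; cells-light = λ { zero → ≤-<-trans (wF-⊆ (proj₁ ∘ ∈-cell⁻ L ∅ one-cell zero)) light } }
    where
    one-cell : Fin n → Fin 1
    one-cell _ = zero

  module _ {L : Subset n} {δ : Fin m} where

    admitting⊆L : admitting L δ ⊆ L
    admitting⊆L = p─q⊆p L _

    forbidding⊆L : forbidding L δ ⊆ L
    forbidding⊆L = p∩q⊆p L _

    admitting-δ∉F : ∀ {v} → v ∈ admitting L δ → δ ∉ F v
    admitting-δ∉F v∈ = x∈p─q⇒x∉q L _ v∈ ∘ ∈-forbidders⁺ {F = F}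

    admitting⇒∉forbidding : ∀ {v} → v ∈ admitting L δ → v ∉ forbidding L δ
    admitting⇒∉forbidding v∈ = x∈p─q⇒x∉q L _ v∈ ∘ proj₂ ∘ x∈p∩q⁻ L _

    ∉admitting⇒∈forbidding : ∀ {v} → v ∈ L → v ∉ admitting L δ → v ∈ forbidding L δ
    ∉admitting⇒∈forbidding {v} v∈L v∉ with v ∈? forbidders F δ
    ... | yes v∈F = x∈p∩q⁺ (v∈L , v∈F)
    ... | no  v∉F = contradiction (x∈p∧x∉q⇒x∈p─q v∈L v∉F) v∉

    colourAdmitting : ∀ {r A} → δ ∈ A → k ≤ wF (admitting L δ) →
                      ClassSplit r (forbidding L δ) (A - δ) → ClassSplit (suc r) L A
    colourAdmitting {r} {A} δ∈A heavy σ = record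
      { q = suc q ; t = t ; q+t≡r = cong suc q+t≡r
      ; X = admitting L δ ∪ X
      ; X⊆L = ∪-⊆ admitting⊆L (forbidding⊆L ∘ X⊆L)
      ; palette = ⁅ δ ⁆ ∪ palette
      ; palette⊆A = ∪-⊆ ⁅δ⁆⊆A (p─q⊆p A ⁅ δ ⁆ ∘ palette⊆A)
      ; ∣palette∣≤q = ≤-trans (∣p∪q∣≤∣p∣+∣q∣ ⁅ δ ⁆ palette)
                              (+-mono-≤ (≤-reflexive (∣⁅x⁆∣≡1 δ)) ∣palette∣≤q)
      ; colour = colour′
      ; colour∈palette = colour′∈palette
      ; colour∉F = colour′∉F
      ; q*k≤wX = ≤-trans (+-mono-≤ heavy q*k≤wX) (≤-reflexive (sym wX≡))
      ; part = part
      ; cells-light = λ j → ≤-<-trans (wF-⊆ (cell-shrinks j)) (cells-light j) }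
      where
      open ClassSplit σ

      ⁅δ⁆⊆A : ⁅ δ ⁆ ⊆ A
      ⁅δ⁆⊆A γ∈⁅δ⁆ = subst (_∈ A) (sym (x∈⁅y⁆⇒x≡y δ γ∈⁅δ⁆)) δ∈A

      wX≡ : wF (admitting L δ ∪ X) ≡ wF (admitting L δ) + wF X
      wX≡ = weight-∪ _ (λ v∈ → admitting⇒∉forbidding v∈ ∘ X⊆L)

      colour′ : Fin n → Fin m
      colour′ v with v ∈? admitting L δ
      ... | yes _ = δ
      ... | no  _ = colour v

      inX : ∀ {v} → v ∈ admitting L δ ∪ X → v ∉ admitting L δ → v ∈ X
      inX {v} v∈ v∉ = [ (λ v∈adm → contradiction v∈adm v∉) , id ]′ (x∈p∪q⁻ (admitting L δ) X v∈)

      colour′∈palette : ∀ {v} → v ∈ admitting L δ ∪ X → colour′ v ∈ ⁅ δ ⁆ ∪ palette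
      colour′∈palette {v} v∈ with v ∈? admitting L δ
      ... | yes _   = x∈p∪q⁺ (inj₁ (x∈⁅x⁆ δ))
      ... | no  v∉  = x∈p∪q⁺ (inj₂ (colour∈palette (inX v∈ v∉)))

      colour′∉F : ∀ {v} → v ∈ admitting L δ ∪ X → colour′ v ∉ F v
      colour′∉F {v} v∈ with v ∈? admitting L δ
      ... | yes v∈adm = admitting-δ∉F v∈adm
      ... | no  v∉    = colour∉F (inX v∈ v∉)

      cell-shrinks : ∀ j → cell L (admitting L δ ∪ X) part j ⊆ cell (forbidding L δ) X part j
      cell-shrinks j v∈ with ∈-cell⁻ L (admitting L δ ∪ X) part j v∈
      ... | v∈L , v∉ , part≡j = ∈-cell⁺ (forbidding L δ) X part j
              (∉admitting⇒∈forbidding v∈L (v∉ ∘ x∈p∪q⁺ ∘ inj₁)) (v∉ ∘ x∈p∪q⁺ ∘ inj₂) part≡j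

    cutAdmitting : ∀ {r A} → wF (admitting L δ) < k →
                   ClassSplit r (forbidding L δ) A → ClassSplit (suc r) L A
    cutAdmitting {r} {A} light σ = record
      { q = q ; t = suc t ; q+t≡r = trans (+-suc q t) (cong suc q+t≡r)
      ; X = X ; X⊆L = forbidding⊆L ∘ X⊆L
      ; palette = palette ; palette⊆A = palette⊆A ; ∣palette∣≤q = ∣palette∣≤q
      ; colour = colour ; colour∈palette = colour∈palette ; colour∉F = colour∉F
      ; q*k≤wX = q*k≤wX
      ; part = part′
      ; cells-light = cells-light′ }
      where
      open ClassSplit σ

      part′ : Fin n → Fin (suc (suc t))
      part′ v with v ∈? admitting L δ
      ... | yes _ = zero
      ... | no  _ = suc (part v)

      first-cell : ∀ {v} → part′ v ≡ zero → v ∈ admitting L δ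
      first-cell {v} with v ∈? admitting L δ
      ... | yes v∈ = λ _ → v∈
      ... | no  _  = λ ()

      later-cell : ∀ {v j} → part′ v ≡ suc j → v ∉ admitting L δ × part v ≡ j
      later-cell {v} with v ∈? admitting L δ
      ... | yes _ = λ ()
      ... | no  v∉ = λ part′≡ → v∉ , suc-injective part′≡

      cells-light′ : ∀ j → wF (cell L X part′ j) < k
      cells-light′ zero    = ≤-<-trans (wF-⊆ first-cell⊆) light
        where
        first-cell⊆ : cell L X part′ zero ⊆ admitting L δ
        first-cell⊆ v∈ = first-cell (proj₂ (proj₂ (∈-cell⁻ L X part′ zero v∈)))
      cells-light′ (suc j) = ≤-<-trans (wF-⊆ later-cell⊆) (cells-light j)
        where
        later-cell⊆ : cell L X part′ (suc j) ⊆ cell (forbidding L δ) X part j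
        later-cell⊆ v∈ with ∈-cell⁻ L X part′ (suc j) v∈
        ... | v∈L , v∉X , part′≡ with later-cell part′≡
        ...   | v∉adm , part≡j =
          ∈-cell⁺ (forbidding L δ) X part j (∉admitting⇒∈forbidding v∈L v∉adm) v∉X part≡j

  classSplit : ∀ r {L A} → Bounded L → wF L < suc r * k → k + r ≤ suc ∣ A ∣ → ClassSplit r L A
  classSplit zero    bounded light _ = noSplit (<-≤-trans light (≤-reflexive (+-identityʳ k)))
  classSplit (suc r) {L} {A} bounded light room =
    extend (rarelyForbidden {r} bounded light (m+n≤o⇒m≤o k r≤))
    where
    r≤ : k + r ≤ ∣ A ∣
    r≤ = ≤-pred (≤-trans (≤-reflexive (sym (+-suc k r))) room)

    recurse : ∀ {δ A′} → wF (forbidding L δ) < suc r * k → k + r ≤ suc ∣ A′ ∣ →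
              ClassSplit r (forbidding L δ) A′
    recurse light′ = classSplit r (bounded ∘ forbidding⊆L) light′

    extend : ∃[ δ ] δ ∈ A × wF (forbidding L δ) < suc r * k → ClassSplit (suc r) L A
    extend (δ , δ∈A , light′) with k ≤? wF (admitting L δ)
    ... | yes heavy  = colourAdmitting δ∈A heavy (recurse light′ (≤-trans r≤ (∣p∣≤1+∣p-x∣ A δ)))
    ... | no  ¬heavy = cutAdmitting (≰⇒> ¬heavy) (recurse light′ (m≤n⇒m≤1+n r≤))

  roomAfter : ∀ {r x L U} (σ : ClassSplit r L (∁ U)) → k + (r + x) ≤ suc ∣ ∁ U ∣ →
              k + x ≤ suc ∣ ∁ (U ∪ ClassSplit.palette σ) ∣
  roomAfter {r} {x} {U = U} σ room = +-cancelʳ-≤ r _ _ (begin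
    k + x + r                                ≡⟨ +-assoc k x r ⟩
    k + (x + r)                              ≡⟨ cong (k +_) (+-comm x r) ⟩
    k + (r + x)                              ≤⟨ room ⟩
    suc ∣ ∁ U ∣                              ≤⟨ s≤s (∣∁p∣≤∣∁[p∪q]∣+∣q∣ U palette) ⟩
    suc (∣ ∁ (U ∪ palette) ∣ + ∣ palette ∣)  ≤⟨ s≤s (+-monoʳ-≤ _ (≤-trans ∣palette∣≤q q≤r)) ⟩
    suc ∣ ∁ (U ∪ palette) ∣ + r              ∎)
    where
    open ClassSplit σ
    open ≤-Reasoning

  record PaletteAssignment {c} (L : Fin c → Subset n) (p : Fin c → ℕ) (U : Subset m) : Set where
    field
      available         : Fin c → Subset m
      split             : ∀ i → ClassSplit (p i) (L i) (available i)
      available⊆∁U      : ∀ i → available i ⊆ ∁ U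
      palettes-disjoint : ∀ {i j} → i ≢ j → ∀ {γ} →
                          γ ∈ ClassSplit.palette (split i) → γ ∉ ClassSplit.palette (split j)

  assignPalettes : ∀ {c} {L : Fin c → Subset n} {p : Fin c → ℕ} {U : Subset m} →
                   (∀ i → Bounded (L i)) → (∀ i → wF (L i) < suc (p i) * k) →
                   k + ΣFin c p ≤ suc ∣ ∁ U ∣ → PaletteAssignment L p U
  assignPalettes {zero} _ _ _ = record
    { available = λ () ; split = λ () ; available⊆∁U = λ () ; palettes-disjoint = λ { {()} } }
  assignPalettes {suc c} {L} {p} {U} bounded light room = record
    { available = available′ ; split = split′
    ; available⊆∁U = available′⊆∁U ; palettes-disjoint = disjoint }
    where
    σ₀ : ClassSplit (p zero) (L zero) (∁ U)
    σ₀ = classSplit (p zero) (bounded zero) (light zero)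
                    (≤-trans (+-monoʳ-≤ k (m≤m+n (p zero) _)) room)

    palette₀ : Subset m
    palette₀ = ClassSplit.palette σ₀

    rest : PaletteAssignment (L ∘ suc) (p ∘ suc) (U ∪ palette₀)
    rest = assignPalettes (bounded ∘ suc) (light ∘ suc) (roomAfter σ₀ room)
    open PaletteAssignment rest

    available′ : Fin (suc c) → Subset m
    available′ zero    = ∁ U
    available′ (suc i) = available i

    split′ : ∀ i → ClassSplit (p i) (L i) (available′ i)
    split′ zero    = σ₀
    split′ (suc i) = split i

    available′⊆∁U : ∀ i → available′ i ⊆ ∁ U
    available′⊆∁U zero    = id
    available′⊆∁U (suc i) = p⊆q⇒∁p⊇∁q (p⊆p∪q palette₀) ∘ available⊆∁U i

    palette₀-disjoint : ∀ {j γ} → γ ∈ palette₀ → γ ∉ ClassSplit.palette (split j)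
    palette₀-disjoint {j} γ∈₀ γ∈j =
      x∈∁p⇒x∉p (available⊆∁U j (ClassSplit.palette⊆A (split j) γ∈j)) (q⊆p∪q U palette₀ γ∈₀)

    disjoint : ∀ {i j} → i ≢ j → ∀ {γ} →
               γ ∈ ClassSplit.palette (split′ i) → γ ∉ ClassSplit.palette (split′ j)
    disjoint {zero}  {zero}  i≢j = contradiction refl i≢j
    disjoint {zero}  {suc j} _   = palette₀-disjoint
    disjoint {suc i} {zero}  _   = flip palette₀-disjoint
    disjoint {suc i} {suc j} i≢j = palettes-disjoint (i≢j ∘ cong suc)

-- Assembling the colouring

m<[1+m/n]*n : ∀ m n .{{_ : NonZero n}} → m < suc (m / n) * n
m<[1+m/n]*n m n = begin-strict
  m                    ≡⟨ m≡m%n+[m/n]*n m n ⟩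
  m % n + (m / n) * n  <⟨ +-monoˡ-< ((m / n) * n) (m%n<n m n) ⟩
  n + (m / n) * n      ∎
  where open ≤-Reasoning

enoughFreshColours-arith : ∀ b x y u m → y + x < 2 * suc b → u ≤ y → 3 * suc b ∸ 1 ≤ m →
                           suc b + x ≤ m ∸ u
enoughFreshColours-arith b x y u m y+x<2k u≤y 3k-1≤m = m+n≤o⇒m≤o∸n (suc b + x) (begin
  suc b + x + u      ≤⟨ +-monoʳ-≤ (suc b + x) u≤y ⟩
  suc b + x + y      ≡⟨ shuffle b x y ⟩
  b + suc (y + x)    ≤⟨ +-monoʳ-≤ b y+x<2k ⟩
  3 * suc b ∸ 1      ≤⟨ 3k-1≤m ⟩
  m                  ∎)
  where
  open ≤-Reasoning
  shuffle : ∀ b x y → suc b + x + y ≡ b + suc (y + x)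
  shuffle = solve-∀

ΣFin-weight-Pclass : ∀ {n m χ} (f : Fin n → ℕ) (T : Template n m) (s : Fin n → Fin χ) →
  ΣFin χ (λ i → weight f (Pclass T s i)) ≡ ΣFin n (λ v → if lookup (S T) v then 0 else f v)
ΣFin-weight-Pclass {n} {m} {χ} f T s = begin
  ΣFin χ (λ i → weight f (Pclass T s i))  ≡⟨ ΣFin-comm entry ⟩
  ΣFin n (λ v → ΣFin χ (λ i → entry i v)) ≡⟨ ΣFin-cong column ⟩
  ΣFin n (λ v → if lookup (S T) v then 0 else f v) ∎
  where
  open ≡-Reasoning
  entry : Fin χ → Fin n → ℕ
  entry i v = if lookup (Pclass T s i) v then f v else 0

  lookup-Pclass : ∀ i v → lookup (Pclass T s i) v ≡ (⌊ s v ≟ i ⌋ ∧ not (lookup (S T) v))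
  lookup-Pclass i = lookup∘tabulate (λ u → ⌊ s u ≟ i ⌋ ∧ not (lookup (S T) u))

  column : ∀ v → ΣFin χ (λ i → entry i v) ≡ (if lookup (S T) v then 0 else f v)
  column v = trans (ΣFin-cong (λ i → cong (λ e → if e then f v else 0) (lookup-Pclass i v)))
                   (trans (ΣFin-one-hot (s v) _ (f v)) (flipped (lookup (S T) v)))
    where
    flipped : ∀ x → (if not x then f v else 0) ≡ (if x then 0 else f v)
    flipped true  = refl
    flipped false = refl

module Extension {n m χ : ℕ} (b : ℕ) (G : Graph n) (T : Template n m) (s : Fin n → Fin χ) where
  open Greedy b (F T) (c T) public

  budget : Fin χ → ℕ
  budget = pval k G T s

  used : Subset m
  used = image (c T) (S T)

  classes-bounded : (∀ v → v ∉ S T → ∣ F T v ∣ ≤ b) → ∀ i → Bounded (Pclass T s i)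
  classes-bounded F-bounded i v∈ = F-bounded _ (proj₂ (∈-Pclass⁻ {T = T} {s} {i} v∈))

  classes-light : ∀ i → wF (Pclass T s i) < suc (budget i) * k
  classes-light i = m<[1+m/n]*n (wF (Pclass T s i)) k

  enoughFreshColours : cost k G T < 2 * k * k → 3 * k ∸ 1 ≤ m → k + ΣFin χ budget ≤ suc ∣ ∁ used ∣
  enoughFreshColours cost< 3k-1≤m =
    m≤n⇒m≤1+n (subst (k + ΣFin χ budget ≤_) (sym (∣∁p∣≡n∸∣p∣ used))
      (enoughFreshColours-arith b (ΣFin χ budget) ∣ S T ∣ ∣ used ∣ m
                                ∣S∣+Σbudget<2k (∣image∣≤∣∣ (c T) (S T)) 3k-1≤m))
    where
    open ≤-Reasoning
    W₀ : ℕ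
    W₀ = ΣFin n (λ v → if lookup (S T) v then 0 else ∣ F T v ∣)

    Σbudget*k≤W₀ : ΣFin χ budget * k ≤ W₀
    Σbudget*k≤W₀ = begin
      ΣFin χ budget * k                 ≡⟨ ΣFin-*ʳ budget k ⟩
      ΣFin χ (λ i → budget i * k)       ≤⟨ ΣFin-mono (λ i → m/n*n≤m (wF (Pclass T s i)) k) ⟩
      ΣFin χ (λ i → wF (Pclass T s i))  ≡⟨ ΣFin-weight-Pclass _ T s ⟩
      W₀                                ∎

    ∣S∣+Σbudget<2k : ∣ S T ∣ + ΣFin χ budget < 2 * k
    ∣S∣+Σbudget<2k = *-cancelˡ-< k _ _ (begin-strict
      k * (∣ S T ∣ + ΣFin χ budget)    ≡⟨ *-distribˡ-+ k ∣ S T ∣ _ ⟩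
      k * ∣ S T ∣ + k * ΣFin χ budget  ≤⟨ +-monoʳ-≤ (k * ∣ S T ∣) k*Σbudget≤W₀ ⟩
      k * ∣ S T ∣ + W₀                 <⟨ cost< ⟩
      2 * k * k                        ≡⟨ *-comm (2 * k) k ⟩
      k * (2 * k)                      ∎)
      where
      k*Σbudget≤W₀ : k * ΣFin χ budget ≤ W₀
      k*Σbudget≤W₀ = ≤-trans (≤-reflexive (*-comm k _)) Σbudget*k≤W₀

  module Colouring (T-proper : TemplateProper k G T) (s-proper : IsProperColoring G s)
                   (π : PaletteAssignment (Pclass T s) budget used) where
    open PaletteAssignment π
    module σ (i : Fin χ) = ClassSplit (split i)

    q : Fin χ → ℕ
    q = σ.q

    P′ : Fin χ → Subset n
    P′ = σ.X

    P′-class : ∀ {i v} → v ∈ P′ i → s v ≡ i × v ∉ S T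
    P′-class {i} v∈ = ∈-Pclass⁻ {T = T} {s} {i} (σ.X⊆L i v∈)

    c₁ : Fin n → Fin m
    c₁ v with v ∈? S T
    ... | yes _ = c T v
    ... | no  _ = σ.colour (s v) v

    c₁-on-S : ∀ v → v ∈ S T → c₁ v ≡ c T v
    c₁-on-S v v∈S with v ∈? S T
    ... | yes _   = refl
    ... | no  v∉S = contradiction v∈S v∉S

    c₁-on-P′ : ∀ {i v} → v ∈ P′ i → c₁ v ≡ σ.colour i v
    c₁-on-P′ {i} {v} v∈ with P′-class v∈
    ... | sv≡i , v∉S with v ∈? S T
    ...   | yes v∈S = contradiction v∈S v∉S
    ...   | no  _   = cong (λ j → σ.colour j v) sv≡i

    c₁∈palette : ∀ {i v} → v ∈ P′ i → c₁ v ∈ σ.palette i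
    c₁∈palette {i} v∈ = subst (_∈ σ.palette i) (sym (c₁-on-P′ v∈)) (σ.colour∈palette i v∈)

    c₁-avoids-F : ∀ v → (∃[ i ] v ∈ P′ i) → c₁ v ∉ F T v
    c₁-avoids-F v (i , v∈) = subst (_∉ F T v) (sym (c₁-on-P′ v∈)) (σ.colour∉F i v∈)

    S-vs-P′ : ∀ {u v i} → u ∈ S T → v ∈ P′ i → c₁ u ≢ c₁ v
    S-vs-P′ {u} {v} {i} u∈S v∈ c₁u≡c₁v =
      x∈∁p⇒x∉p (available⊆∁U i (σ.palette⊆A i (c₁∈palette v∈)))
               (subst (_∈ used) (trans (sym (c₁-on-S u u∈S)) c₁u≡c₁v) (∈-image⁺ u∈S))

    c₁-proper : ∀ u v → (u ∈ S T ⊎ ∃[ i ] u ∈ P′ i) → (v ∈ S T ⊎ ∃[ i ] v ∈ P′ i) →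
                Adj G u v → c₁ u ≢ c₁ v
    c₁-proper u v (inj₁ u∈S) (inj₁ v∈S) u~v eq =
      T-proper u v u∈S v∈S u~v (trans (sym (c₁-on-S u u∈S)) (trans eq (c₁-on-S v v∈S)))
    c₁-proper u v (inj₁ u∈S) (inj₂ (_ , v∈)) _ = S-vs-P′ u∈S v∈
    c₁-proper u v (inj₂ (_ , u∈)) (inj₁ v∈S) _ = S-vs-P′ v∈S u∈ ∘ sym
    c₁-proper u v (inj₂ (i , u∈)) (inj₂ (j , v∈)) u~v eq with i ≟ j
    ... | yes refl = s-proper u v u~v (trans (proj₁ (P′-class u∈)) (sym (proj₁ (P′-class v∈))))
    ... | no  i≢j  =
      palettes-disjoint i≢j (c₁∈palette u∈) (subst (_∈ σ.palette j) (sym eq) (c₁∈palette v∈))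

    ∣image-c₁∣≤q : ∀ i → ∣ image c₁ (P′ i) ∣ ≤ q i
    ∣image-c₁∣≤q i = ≤-trans (p⊆q⇒∣p∣≤∣q∣ image⊆palette) (σ.∣palette∣≤q i)
      where
      image⊆palette : image c₁ (P′ i) ⊆ σ.palette i
      image⊆palette γ∈ with ∈-image⁻ {f = c₁} {P = P′ i} γ∈
      ... | v , v∈ , refl = c₁∈palette v∈

lemma4p5 : (k : ℕ) .{{_ : NonZero k}} (m : ℕ) → 3 * k ∸ 1 ≤ m
    → (n : ℕ) (G : Graph n) → Inextensible k m G
    → (χ : ℕ) → IsChromaticNumber G χ
    → (s : Fin n → Fin χ) → IsProperColoring G s
    → (T : Template n m) → Good k G T
    → Σ (Fin χ → ℕ) λ q → Σ (Fin χ → Subset n) λ P′ →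
        (∀ i → q i ≤ pval k G T s i)
      × (∀ i → P′ i ⊆ Pclass T s i)
      × (∀ i → (q i * k ≤ w k G T (P′ i))
             × (Σ (Fin n → Fin (suc (pval k G T s i ∸ q i))) λ part →
                  ∀ j → w k G T (cell (Pclass T s i) (P′ i) part j) < k))
      × (Σ (Fin n → Fin m) λ c₁ →
            (∀ u v → (u ∈ S T ⊎ ∃[ i ] u ∈ P′ i) → (v ∈ S T ⊎ ∃[ i ] v ∈ P′ i)
               → Adj G u v → c₁ u ≢ c₁ v)
          × (∀ v → v ∈ S T → c₁ v ≡ c T v)
          × (∀ v → (∃[ i ] v ∈ P′ i) → c₁ v ∉ F T v)
          × (∀ i → ∣ image c₁ (P′ i) ∣ ≤ q i))
lemma4p5 (suc b) m 3k-1≤m n G _ χ _ s s-proper T ((T-proper , cost< , _ , _) , F-bounded) =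
    q , P′ , σ.q≤r , σ.X⊆L , (λ i → σ.q*k≤wX i , σ.lightPartition i)
  , c₁ , c₁-proper , c₁-on-S , c₁-avoids-F , ∣image-c₁∣≤q
  where
  open Extension b G T s
  open Colouring T-proper s-proper
    (assignPalettes (classes-bounded F-bounded) classes-light (enoughFreshColours cost< 3k-1≤m))
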